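{- Let $G$ be a reduction graph and $e\in E(G)$ an edge. Let $e'$ be a reduction edge with $w(e') = w(e)$ such that every output of $e'$ is an output of $e$ and every input of $e$ is an input of $e'$, and let $V'$ be the set of inputs of $e'$ that are not inputs of $e$ (taken as new nodes). Let $G'$ be the graph with $V(G') = V(G)\cup V'$ and $E(G') = (E(G)\setminus\{e\})\cup\{e'\}$ (an enrichment of $G$). Then $G'$ is a reduction graph and $\mathrm{Bal}(G') = \mathrm{Bal}(G)$.
   Context: $\mathbb{N}$ = nonnegative integers; $\langle a\rangle := \{an : n\in\mathbb{N}\}$. For sets $A,B$, $A+B := \{a+b\}$; $C=A\oplus B$ means $C=A+B$ with unique representations. For a (possibly infinite) family of sets containing $0$, $\sum_i A_i$ is the set of all finite sums of elements from distinct members. A reduction edge $e$ has input nodes $B_j$ and output nodes $A_i$ (nonempty subsets of $\mathbb{N}$ containing $0$) and a finite remainder set $\mathrm{Rem}(e)$ with $\sum_i A_i + \sum_j B_j = (\sum_i A_i)\oplus\mathrm{Rem}(e)$; its weight is $w(e):=|\mathrm{Rem}(e)|$. A reduction graph $G$ consists of a multicollection $V(G)$ of such nodes and a finite set $E(G)$ of reduction edges among them; viewing edges as arrows from inputs to outputs, $G$ is acyclic; exactly one node (the root) is an input of no edge and equals $\langle r(G)\rangle$ for a positive integer $r(G)$; every other node is an input of exactly one edge. $\mathrm{Bal}(G) := r(G)/\prod_{e\in E(G)} w(e)$. -}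

module Defs where

open import Level using (0ℓ)
open import Data.Nat using (ℕ; zero; suc; _+_; _*_; _>_)
open import Data.Fin using (Fin; _↑ˡ_; _↑ʳ_)
open import Data.List using (List; []; _∷_; map; length; _++_; allFin)
open import Data.Nat.ListAction using (product)
open import Data.List.Membership.Propositional using (_∈_; _∉_)
open import Data.List.Relation.Unary.Unique.Propositional using (Unique)
open import Data.Product using (Σ; ∃; ∃₂; _×_; _,_)
open import Data.Integer using (+_)
open import Data.Rational using (ℚ; 0ℚ; _/_)
open import Data.Vec.Functional using (Vector; updateAt) renaming (_++_ to _++ᵛ_)
open import Function using (_∘_; const)
open import Relation.Nullary using (¬_)
open import Relation.Binary.PropositionalEquality using (_≡_; _≢_)
open import Relation.Binary.Construct.Closure.Transitive using (TransClosure)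

SubsetN : Set₁
SubsetN = ℕ → Set

_≐_ : SubsetN → SubsetN → Set
A ≐ B = ∀ n → (A n → B n) × (B n → A n)

_⊞_ : SubsetN → SubsetN → SubsetN
(A ⊞ B) n = ∃₂ λ a b → A a × B b × n ≡ a + b

DirectSum : SubsetN → SubsetN → SubsetN → Set
DirectSum C A B =
  (C ≐ (A ⊞ B)) ×
  (∀ {a a′ b b′} → A a → A a′ → B b → B b′ → a + b ≡ a′ + b′ → (a ≡ a′) × (b ≡ b′))

⟨_⟩ : ℕ → SubsetN
⟨ a ⟩ x = ∃ λ k → x ≡ a * k

-- Sum of a finite family of sets containing 0: all finite sums of elements
-- from distinct members (for a finite family, the iterated sumset; {0} if empty).
ΣS : List SubsetN → SubsetN
ΣS []       n = n ≡ 0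
ΣS (A ∷ As) = A ⊞ ΣS As

⟦_⟧ : List ℕ → SubsetN
⟦ xs ⟧ x = x ∈ xs

record Node : Set₁ where
  field
    set  : SubsetN
    has0 : set 0
open Node public

IsReductionEdge : (ins outs : List SubsetN) → List ℕ → Set
IsReductionEdge ins outs rem = DirectSum (ΣS outs ⊞ ΣS ins) (ΣS outs) ⟦ rem ⟧

-- Graph data: n nodes (a multicollection, indexed by Fin n), m edges.

record Edge (n : ℕ) : Set where
  field
    inputs  : List (Fin n)
    outputs : List (Fin n)
    rem     : List ℕ
open Edge public

weight : ∀ {n} → Edge n → ℕ
weight e = length (rem e)

record RGraph : Set₁ where
  field
    n    : ℕ
    m    : ℕ
    node : Fin n → Node
    edge : Fin m → Edge n
open RGraph public

ValidEdge : ∀ {n} → (Fin n → Node) → Edge n → Set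
ValidEdge nd e =
  Unique (inputs e) × Unique (outputs e) × Unique (rem e) ×
  IsReductionEdge (map (set ∘ nd) (inputs e)) (map (set ∘ nd) (outputs e)) (rem e)

Step : (G : RGraph) → Fin (n G) → Fin (n G) → Set
Step G u v = ∃ λ e → u ∈ inputs (edge G e) × v ∈ outputs (edge G e)

record IsReductionGraph (G : RGraph) : Set₁ where
  field
    edgesValid : ∀ e → ValidEdge (node G) (edge G e)
    acyclic    : ∀ u → ¬ TransClosure (Step G) u u
    root       : Fin (n G)
    rootFree   : ∀ e → root ∉ inputs (edge G e)
    othersOnce : ∀ v → v ≢ root →
                   ∃ λ e → v ∈ inputs (edge G e) × (∀ e′ → v ∈ inputs (edge G e′) → e′ ≡ e)
    r          : ℕ
    r>0        : r > 0
    rootIs     : set (node G root) ≐ ⟨ r ⟩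
open IsReductionGraph public

-- division of naturals into ℚ (junk value 0 for denominator 0, which never
-- occurs for reduction graphs since 0 ∈ Rem(e) for every edge)
_/ℕ_ : ℕ → ℕ → ℚ
a /ℕ zero  = 0ℚ
a /ℕ suc d = (+ a) / suc d

prodWeights : (G : RGraph) → ℕ
prodWeights G = product (map (weight ∘ edge G) (allFin (m G)))

Bal : (G : RGraph) → IsReductionGraph G → ℚ
Bal G p = r p /ℕ prodWeights G

liftEdge : ∀ {n} (k : ℕ) → Edge n → Edge (n + k)
liftEdge k e = record
  { inputs  = map (_↑ˡ k) (inputs e)
  ; outputs = map (_↑ˡ k) (outputs e)
  ; rem     = rem e }

newEdge : (G : RGraph) (e : Fin (m G)) (k : ℕ) → List (Fin (n G)) → List ℕ → Edge (n G + k)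
newEdge G e k outs′ rem′ = record
  { inputs  = map (_↑ˡ k) (inputs (edge G e)) ++ map (n G ↑ʳ_) (allFin k)
  ; outputs = map (_↑ˡ k) outs′
  ; rem     = rem′ }

enrich : (G : RGraph) (e : Fin (m G)) (k : ℕ) (N : Fin k → Node)
         (outs′ : List (Fin (n G))) (rem′ : List ℕ) → RGraph
enrich G e k N outs′ rem′ = record
  { n    = n G + k
  ; m    = m G
  ; node = node G ++ᵛ N
  ; edge = updateAt (liftEdge k ∘ edge G) e (const (newEdge G e k outs′ rem′)) }

{-# OPTIONS --safe #-}
module Submission where

-- Every
-- edge of the enrichment still has only old nodes as outputs, so every arrow ends
-- at an old node and a cycle in the enrichment is a cycle over old nodes, i.e. a
-- cycle in G (outputs of e′ are outputs of e, and on old nodes the inputs of e′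
-- are those of e). The new nodes are inputs of e′ only, the root and r are
-- untouched, and w(e′) = w(e) leaves the product of the weights unchanged.

open import Defs
open import Data.Nat using (ℕ; _+_)
open import Data.Fin using (Fin; _↑ˡ_; _↑ʳ_; splitAt)
open import Data.Fin.Properties using (↑ˡ-injective; splitAt-↑ˡ; splitAt-↑ʳ; splitAt⁻¹-↑ˡ; splitAt⁻¹-↑ʳ; _≟_)
open import Data.List using (List; length; map; allFin)
open import Data.Nat.ListAction using (product)
open import Data.List.Properties using (map-cong; map-∘)
open import Data.List.Membership.Propositional using (_∈_; _∉_)
open import Data.List.Membership.Propositional.Properties using (∈-map⁻; ∈-map⁺; ∈-++⁻; ∈-++⁺ˡ; ∈-++⁺ʳ; ∈-allFin)
open import Data.List.Relation.Binary.Subset.Propositional using (_⊆_)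
open import Data.List.Relation.Unary.Unique.Propositional.Properties using (map⁺)
open import Data.Product using (Σ; ∃; _×_; _,_)
open import Data.Sum using (inj₁; inj₂; [_,_]′)
open import Data.Empty using (⊥-elim)
open import Data.Vec.Functional using (Vector) renaming (_++_ to _++ᵛ_)
open import Data.Vec.Functional.Properties using (updateAt-updates; updateAt-minimal; lookup-++ˡ)
open import Function using (_∘_)
open import Function.Definitions using (Injective)
open import Relation.Nullary using (¬_; yes; no)
open import Relation.Binary.PropositionalEquality using (_≡_; _≢_; refl; sym; trans; cong; subst; subst₂)
open import Relation.Binary.Construct.Closure.Transitive using (TransClosure; [_]; _∷_)

↑ˡ≢↑ʳ : ∀ {m n} (i : Fin m) (j : Fin n) → i ↑ˡ n ≢ m ↑ʳ j
↑ˡ≢↑ʳ {m} {n} i j eq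
  with trans (sym (splitAt-↑ˡ m i n)) (trans (cong (splitAt m) eq) (splitAt-↑ʳ m n j))
... | ()

∈-map-injective⁻ : ∀ {A B : Set} {f : A → B} → Injective _≡_ _≡_ f →
                   ∀ {x xs} → f x ∈ map f xs → x ∈ xs
∈-map-injective⁻ f-inj fx∈ with y , y∈ , fx≡fy ← ∈-map⁻ _ fx∈ =
  subst (_∈ _) (sym (f-inj fx≡fy)) y∈

↑ˡ∉map-↑ʳ : ∀ {m n} {i : Fin m} {js : List (Fin n)} → i ↑ˡ n ∉ map (m ↑ʳ_) js
↑ˡ∉map-↑ʳ i∈ with j , _ , eq ← ∈-map⁻ _ i∈ = ↑ˡ≢↑ʳ _ j eq

↑ʳ∉map-↑ˡ : ∀ {m n} {j : Fin n} {is : List (Fin m)} → m ↑ʳ j ∉ map (_↑ˡ n) is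
↑ʳ∉map-↑ˡ j∈ with i , _ , eq ← ∈-map⁻ _ j∈ = ↑ˡ≢↑ʳ i _ (sym eq)

map-++ᵛ-↑ˡ : ∀ {a b} {A : Set a} {B : Set b} {m n} (f : A → B) (u : Vector A m) (v : Vector A n)
             (is : List (Fin m)) → map (f ∘ (u ++ᵛ v)) (map (_↑ˡ n) is) ≡ map (f ∘ u) is
map-++ᵛ-↑ˡ f u v is = trans (sym (map-∘ is)) (map-cong (cong f ∘ lookup-++ˡ u v) is)

liftEdge-valid : ∀ {n k} {nd : Fin n → Node} (M : Fin k → Node) {E : Edge n} →
                 ValidEdge nd E → ValidEdge (nd ++ᵛ M) (liftEdge k E)
liftEdge-valid {k = k} {nd} M {E} (ins-unique , outs-unique , rem-unique , reduction) =
  map⁺ ↑ˡ-inj ins-unique , map⁺ ↑ˡ-inj outs-unique , rem-unique ,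
  subst₂ (λ ins outs → IsReductionEdge ins outs (rem E))
    (sym (map-++ᵛ-↑ˡ set nd M (inputs E))) (sym (map-++ᵛ-↑ˡ set nd M (outputs E))) reduction
  where
  ↑ˡ-inj : ∀ {i j} → i ↑ˡ k ≡ j ↑ˡ k → i ≡ j
  ↑ˡ-inj = ↑ˡ-injective k _ _

module _ {A B : Set} {R : A → A → Set} {S : B → B → Set} (f : A → B)
         (S-target : ∀ {x y} → S x y → ∃ λ y₀ → y ≡ f y₀)
         (S⇒R : ∀ {x y} → S (f x) (f y) → R x y) where

  TransClosure-target : ∀ {x y} → TransClosure S x y → ∃ λ y₀ → y ≡ f y₀
  TransClosure-target [ s ]   = S-target s
  TransClosure-target (_ ∷ t) = TransClosure-target t

  TransClosure-reflect : ∀ {x y} → TransClosure S (f x) (f y) → TransClosure R x y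
  TransClosure-reflect [ s ] = [ S⇒R s ]
  TransClosure-reflect (s ∷ t) with _ , refl ← S-target s = S⇒R s ∷ TransClosure-reflect t

  acyclic-reflect : (∀ x → ¬ TransClosure R x x) → ∀ y → ¬ TransClosure S y y
  acyclic-reflect R-acyclic y cycle with x , refl ← TransClosure-target cycle =
    R-acyclic x (TransClosure-reflect cycle)

module Enrichment (G : RGraph) (e : Fin (m G)) (k : ℕ) (N : Fin k → Node)
                  (outs′ : List (Fin (n G))) (rem′ : List ℕ) where

  G′ : RGraph
  G′ = enrich G e k N outs′ rem′

  e′ : Edge (n G + k)
  e′ = newEdge G e k outs′ rem′

  edge-enrich-elim : (P : Fin (m G) → Edge (n G + k) → Set) →
                     P e e′ → (∀ d → d ≢ e → P d (liftEdge k (edge G d))) →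
                     ∀ d → P d (edge G′ d)
  edge-enrich-elim P Pe Pd d with d ≟ e
  ... | yes refl = subst (P e) (sym (updateAt-updates e (liftEdge k ∘ edge G))) Pe
  ... | no d≢e   = subst (P d) (sym (updateAt-minimal d e (liftEdge k ∘ edge G) d≢e)) (Pd d d≢e)

  inputs-enrich-↑ˡ⁻ : ∀ d {u} → u ↑ˡ k ∈ inputs (edge G′ d) → u ∈ inputs (edge G d)
  inputs-enrich-↑ˡ⁻ d {u} = edge-enrich-elim (λ d E → u ↑ˡ k ∈ inputs E → u ∈ inputs (edge G d))
    ([ ∈-map-injective⁻ (↑ˡ-injective k _ _) , ⊥-elim ∘ ↑ˡ∉map-↑ʳ ]′ ∘ ∈-++⁻ _)
    (λ _ _ → ∈-map-injective⁻ (↑ˡ-injective k _ _)) d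

  inputs-enrich-↑ˡ⁺ : ∀ d {u} → u ∈ inputs (edge G d) → u ↑ˡ k ∈ inputs (edge G′ d)
  inputs-enrich-↑ˡ⁺ d {u} = edge-enrich-elim (λ d E → u ∈ inputs (edge G d) → u ↑ˡ k ∈ inputs E)
    (∈-++⁺ˡ ∘ ∈-map⁺ (_↑ˡ k)) (λ _ _ → ∈-map⁺ (_↑ˡ k)) d

  inputs-enrich-↑ʳ⁻ : ∀ d {j} → n G ↑ʳ j ∈ inputs (edge G′ d) → d ≡ e
  inputs-enrich-↑ʳ⁻ d {j} = edge-enrich-elim (λ d E → n G ↑ʳ j ∈ inputs E → d ≡ e)
    (λ _ → refl) (λ _ _ → ⊥-elim ∘ ↑ʳ∉map-↑ˡ) d

  inputs-enrich-↑ʳ⁺ : ∀ j → n G ↑ʳ j ∈ inputs (edge G′ e)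
  inputs-enrich-↑ʳ⁺ j = subst (λ E → n G ↑ʳ j ∈ inputs E)
    (sym (updateAt-updates e (liftEdge k ∘ edge G)))
    (∈-++⁺ʳ _ (∈-map⁺ (n G ↑ʳ_) (∈-allFin j)))

  outputs-enrich-old : ∀ d {v} → v ∈ outputs (edge G′ d) → ∃ λ v₀ → v ≡ v₀ ↑ˡ k
  outputs-enrich-old d {v} = edge-enrich-elim (λ _ E → v ∈ outputs E → ∃ λ v₀ → v ≡ v₀ ↑ˡ k)
    image (λ _ _ → image) d
    where
    image : ∀ {vs} → v ∈ map (_↑ˡ k) vs → ∃ λ v₀ → v ≡ v₀ ↑ˡ k
    image v∈ with v₀ , _ , eq ← ∈-map⁻ _ v∈ = v₀ , eq

  outputs-enrich-↑ˡ⁻ : outs′ ⊆ outputs (edge G e) →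
                       ∀ d {v} → v ↑ˡ k ∈ outputs (edge G′ d) → v ∈ outputs (edge G d)
  outputs-enrich-↑ˡ⁻ outs′⊆ d {v} =
    edge-enrich-elim (λ d E → v ↑ˡ k ∈ outputs E → v ∈ outputs (edge G d))
      (outs′⊆ ∘ ∈-map-injective⁻ (↑ˡ-injective k _ _))
      (λ _ _ → ∈-map-injective⁻ (↑ˡ-injective k _ _)) d

  weight-enrich : length rem′ ≡ weight (edge G e) → ∀ d → weight (edge G′ d) ≡ weight (edge G d)
  weight-enrich w≡ = edge-enrich-elim (λ d E → weight E ≡ weight (edge G d)) w≡ (λ _ _ → refl)

  prodWeights-enrich : length rem′ ≡ weight (edge G e) → prodWeights G′ ≡ prodWeights G
  prodWeights-enrich w≡ = cong product (map-cong (weight-enrich w≡) (allFin (m G)))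

  edges-enrich-valid : ValidEdge (node G′) e′ → (∀ d → ValidEdge (node G) (edge G d)) →
                       ∀ d → ValidEdge (node G′) (edge G′ d)
  edges-enrich-valid e′-valid G-valid =
    edge-enrich-elim (λ _ E → ValidEdge (node G′) E) e′-valid (λ d _ → liftEdge-valid N (G-valid d))

  step-enrich-target : ∀ {u v} → Step G′ u v → ∃ λ v₀ → v ≡ v₀ ↑ˡ k
  step-enrich-target (d , _ , v∈) = outputs-enrich-old d v∈

  step-enrich-↑ˡ⁻ : outs′ ⊆ outputs (edge G e) → ∀ {u v} → Step G′ (u ↑ˡ k) (v ↑ˡ k) → Step G u v
  step-enrich-↑ˡ⁻ outs′⊆ (d , u∈ , v∈) = d , inputs-enrich-↑ˡ⁻ d u∈ , outputs-enrich-↑ˡ⁻ outs′⊆ d v∈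

  InputOfUniqueEdge : Fin (n G′) → Set
  InputOfUniqueEdge v = ∃ λ d → v ∈ inputs (edge G′ d) × (∀ d′ → v ∈ inputs (edge G′ d′) → d′ ≡ d)

  inputOnce-enrich-↑ˡ : (p : IsReductionGraph G) → ∀ i → i ≢ root p → InputOfUniqueEdge (i ↑ˡ k)
  inputOnce-enrich-↑ˡ p i i≢root with d , i∈ , unique ← othersOnce p i i≢root =
    d , inputs-enrich-↑ˡ⁺ d i∈ , λ d′ i∈′ → unique d′ (inputs-enrich-↑ˡ⁻ d′ i∈′)

  inputOnce-enrich-↑ʳ : ∀ j → InputOfUniqueEdge (n G ↑ʳ j)
  inputOnce-enrich-↑ʳ j = e , inputs-enrich-↑ʳ⁺ j , λ d′ j∈ → inputs-enrich-↑ʳ⁻ d′ j∈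

  inputOnce-enrich : (p : IsReductionGraph G) → ∀ v → v ≢ root p ↑ˡ k → InputOfUniqueEdge v
  inputOnce-enrich p v v≢root with splitAt (n G) v in split
  ... | inj₁ i with refl ← splitAt⁻¹-↑ˡ split = inputOnce-enrich-↑ˡ p i (v≢root ∘ cong (_↑ˡ k))
  ... | inj₂ j with refl ← splitAt⁻¹-↑ʳ split = inputOnce-enrich-↑ʳ j

  enrich-isReductionGraph : (p : IsReductionGraph G) → ValidEdge (node G′) e′ →
                            outs′ ⊆ outputs (edge G e) → IsReductionGraph G′
  enrich-isReductionGraph p e′-valid outs′⊆ = record
    { edgesValid = edges-enrich-valid e′-valid (edgesValid p)
    ; acyclic    = acyclic-reflect (_↑ˡ k) step-enrich-target (step-enrich-↑ˡ⁻ outs′⊆) (acyclic p)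
    ; root       = root p ↑ˡ k
    ; rootFree   = λ d root∈ → rootFree p d (inputs-enrich-↑ˡ⁻ d root∈)
    ; othersOnce = inputOnce-enrich p
    ; r          = r p
    ; r>0        = r>0 p
    ; rootIs     = subst (λ X → set X ≐ ⟨ r p ⟩) (sym (lookup-++ˡ (node G) N (root p))) (rootIs p)
    }

lemma5p3 : (G : RGraph) (p : IsReductionGraph G) (e : Fin (m G))
    (k : ℕ) (N : Fin k → Node) (outs′ : List (Fin (n G))) (rem′ : List ℕ) →
    ValidEdge (node G ++ᵛ N) (newEdge G e k outs′ rem′) →
    (∀ {v} → v ∈ outs′ → v ∈ outputs (edge G e)) →
    length rem′ ≡ weight (edge G e) →
    Σ (IsReductionGraph (enrich G e k N outs′ rem′))
      (λ p′ → Bal (enrich G e k N outs′ rem′) p′ ≡ Bal G p)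
lemma5p3 G p e k N outs′ rem′ e′-valid outs′⊆ w≡ =
  enrich-isReductionGraph p e′-valid outs′⊆ , cong (r p /ℕ_) (prodWeights-enrich w≡)
  where open Enrichment G e k N outs′ rem′
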